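{- The rewiring $\phi(\tau)$ of a non-negative $\mathcal{Q}$-tree $\tau$ is a tree with the same necklaces.
   Context: Pearls are of four kinds: box-pearls, dot-pearls, red diamond-pearls and blue triangle-pearls. $\mathcal{Q}$ is a set of words on the alphabet {dot, diamond, triangle}, each identified with a clockwise oriented necklace carrying one box-pearl followed by the letters as pearls. A rooted $\mathcal{Q}$-tree is a box-rooted plane tree whose vertices are necklaces of $\mathcal{Q}$, with black edges joining a dot-pearl to a box-pearl and red edges joining a diamond-pearl to a box-pearl, each pearl incident to exactly one edge except the root box-pearl and the (free) triangle-pearls. The excess of a pearl $x$ is the number of triangle-pearls minus the number of diamond-pearls in the subtree planted at $x$ ($x$ included); a non-negative $\mathcal{Q}$-tree has non-negative excess at every pearl. Around $\tau$, a left diamond-corner is the exterior angular sector following a red edge in counterclockwise direction around a diamond-pearl, and a triangle-corner is the exterior angular sector around a triangle-pearl. The closure $c(\tau)$ is the plane map obtained by iteratively matching an unmatched left diamond-corner followed in clockwise direction around the tree by an unmatched triangle-corner, creating a planar system of non-crossing diamond-to-triangle clockwise edges (blue edges). The rewiring $\phi(\tau)$ is $c(\tau)$ with its red edges removed. -}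

module Defs where

open import Data.Nat using (ℕ; zero; suc; _+_; _≤_; _<_)
open import Data.List using (List; []; _∷_; _++_; length; lookup; map)
open import Data.List.Relation.Unary.All using (All)
open import Data.List.Relation.Unary.Unique.Propositional using (Unique)
open import Data.Fin using (Fin)
open import Data.Product using (_×_; _,_; Σ; ∃; proj₁; proj₂)
open import Data.Sum using (_⊎_)
open import Data.Empty using (⊥)
open import Relation.Binary.PropositionalEquality using (_≡_)

data Letter : Set where
  dot diamond triangle : Letter

-- A (box-)rooted Q-tree: a necklace = box-pearl followed clockwise by the
-- listed pearls.  A dot-pearl carries the subtree hanging from it by a black
-- edge (attached to the child's box-pearl), a diamond-pearl carries the
-- subtree hanging from it by a red edge, a triangle-pearl is free.
mutual
  data QTree : Set where
    neck : List Pearl → QTree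

  data Pearl : Set where
    dotP     : QTree → Pearl
    diamondP : QTree → Pearl
    triangleP : Pearl

letter : Pearl → Letter
letter (dotP _) = dot
letter (diamondP _) = diamond
letter triangleP = triangle

word : QTree → List Letter
word (neck ps) = map letter ps

mutual
  data IsQTree (Q : List Letter → Set) : QTree → Set where
    neck : ∀ {ps} → Q (map letter ps) → IsQTreePs Q ps → IsQTree Q (neck ps)

  data IsQTreePs (Q : List Letter → Set) : List Pearl → Set where
    []  : IsQTreePs Q []
    dot∷ : ∀ {t ps} → IsQTree Q t → IsQTreePs Q ps → IsQTreePs Q (dotP t ∷ ps)
    dia∷ : ∀ {t ps} → IsQTree Q t → IsQTreePs Q ps → IsQTreePs Q (diamondP t ∷ ps)
    tri∷ : ∀ {ps} → IsQTreePs Q ps → IsQTreePs Q (triangleP ∷ ps)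

mutual
  trisT : QTree → ℕ
  trisT (neck ps) = trisPs ps

  trisPs : List Pearl → ℕ
  trisPs [] = 0
  trisPs (dotP t ∷ ps) = trisT t + trisPs ps
  trisPs (diamondP t ∷ ps) = trisT t + trisPs ps
  trisPs (triangleP ∷ ps) = suc (trisPs ps)

mutual
  diasT : QTree → ℕ
  diasT (neck ps) = diasPs ps

  diasPs : List Pearl → ℕ
  diasPs [] = 0
  diasPs (dotP t ∷ ps) = diasT t + diasPs ps
  diasPs (diamondP t ∷ ps) = suc (diasT t + diasPs ps)
  diasPs (triangleP ∷ ps) = diasPs ps

-- excess of a pearl x = #triangles − #diamonds in the subtree planted at x
-- (x included); "excess ≥ 0" is written #diamonds ≤ #triangles.
-- Subtree planted at a box-pearl: the whole necklace subtree;
-- at a dot-pearl: the child subtree; at a diamond-pearl: the pearl itself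
-- plus the child subtree; at a triangle-pearl: the pearl itself.
mutual
  data NonNeg : QTree → Set where
    neck : ∀ {ps} → diasPs ps ≤ trisPs ps → NonNegPs ps → NonNeg (neck ps)

  data NonNegPs : List Pearl → Set where
    []  : NonNegPs []
    dot∷ : ∀ {t ps} → diasT t ≤ trisT t → NonNeg t → NonNegPs ps →
           NonNegPs (dotP t ∷ ps)
    dia∷ : ∀ {t ps} → suc (diasT t) ≤ trisT t → NonNeg t → NonNegPs ps →
           NonNegPs (diamondP t ∷ ps)
    tri∷ : ∀ {ps} → NonNegPs ps → NonNegPs (triangleP ∷ ps)

-- Necklaces are numbered in preorder (root = 0).  A clockwise contour
-- walk around the tree lists the relevant corners: left diamond-corners
-- (visited just before descending along the red edge) and triangle-corners,
-- each tagged with the number of the necklace carrying the pearl.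

data Corner : Set where
  diaC : ℕ → Corner
  triC : ℕ → Corner

Edge : Set
Edge = ℕ × ℕ

record Walked : Set where
  constructor walked
  field
    next    : ℕ            -- next free necklace number
    corners : List Corner
    black   : List Edge    -- black edges (parent necklace, child necklace)
    necks   : List (List Letter)

mutual
  walkT : ℕ → QTree → Walked
  walkT i (neck ps) with walkPs i (suc i) ps
  ... | walked f cs bs ns = walked f cs bs (map letter ps ∷ ns)

  walkPs : ℕ → ℕ → List Pearl → Walked
  walkPs v f [] = walked f [] [] []
  walkPs v f (triangleP ∷ ps) with walkPs v f ps
  ... | walked f' cs bs ns = walked f' (triC v ∷ cs) bs ns
  walkPs v f (dotP t ∷ ps) with walkT f t
  ... | walked f1 cs1 bs1 ns1 with walkPs v f1 ps
  ...   | walked f2 cs2 bs2 ns2 =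
          walked f2 (cs1 ++ cs2) ((v , f) ∷ bs1 ++ bs2) (ns1 ++ ns2)
  walkPs v f (diamondP t ∷ ps) with walkT f t
  ... | walked f1 cs1 bs1 ns1 with walkPs v f1 ps
  ...   | walked f2 cs2 bs2 ns2 =
          walked f2 (diaC v ∷ cs1 ++ cs2) (bs1 ++ bs2) (ns1 ++ ns2)

-- Closure: iterative matching of an unmatched left diamond-corner followed
-- clockwise (among unmatched such corners) by an unmatched triangle-corner.
-- Realised by the usual stack scan of the contour (first pass), followed by
-- the wrap-around of the cyclic contour (second pass).

record Pass1 : Set where
  constructor pass1
  field
    blue1    : List Edge  -- blue edges (diamond necklace, triangle necklace)
    stack    : List ℕ     -- unmatched diamonds, most recent first
    freeTris : List ℕ     -- triangles left unmatched, in contour order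

scan : List ℕ → List Corner → Pass1
scan s [] = pass1 [] s []
scan s (diaC v ∷ cs) = scan (v ∷ s) cs
scan [] (triC w ∷ cs) with scan [] cs
... | pass1 b s' ts = pass1 b s' (w ∷ ts)
scan (v ∷ s) (triC w ∷ cs) with scan s cs
... | pass1 b s' ts = pass1 ((v , w) ∷ b) s' ts

wrap : List ℕ → List ℕ → List Edge
wrap (v ∷ s) (w ∷ ts) = (v , w) ∷ wrap s ts
wrap _ _ = []

blueEdges : List Corner → List Edge
blueEdges cs with scan [] cs
... | pass1 b s ts = b ++ wrap s ts

record NMap : Set where
  constructor nmap
  field
    vertices : List (List Letter) -- the necklaces; vertex i = i-th necklace
    edges    : List Edge

open NMap public

necklaces : QTree → List (List Letter)
necklaces τ = Walked.necks (walkT 0 τ)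

-- rewiring φ(τ): the closure c(τ) with its red edges removed, i.e. the
-- black edges together with the blue edges.
rewiring : QTree → NMap
rewiring τ with walkT 0 τ
... | walked n cs bs ns = nmap ns (bs ++ blueEdges cs)

data Walk (E : List Edge) : ℕ → ℕ → List (Fin (length E)) → Set where
  nil  : ∀ {u} → Walk E u u []
  step : ∀ {u w v is} (i : Fin (length E)) →
         (lookup E i ≡ (u , w) ⊎ lookup E i ≡ (w , u)) →
         Walk E w v is → Walk E u v (i ∷ is)

record IsTree (G : NMap) : Set where
  field
    wellFormed : All (λ e → proj₁ e < length (vertices G) × proj₂ e < length (vertices G)) (edges G)
    connected  : ∀ u v → u < length (vertices G) → v < length (vertices G) →
                 ∃ λ is → Walk (edges G) u v is
    acyclic    : ∀ u i is → Unique (i ∷ is) → Walk (edges G) u u (i ∷ is) → ⊥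

-- Number the necklaces in preorder, so that the necklaces of every subtree
-- form an interval.  Non-negativity means that every red subtree contains
-- more triangle-pearls than diamond-pearls; hence the stack scan of the
-- contour matches each diamond-pearl with the first triangle left free in
-- its own red subtree, the stack is empty at the end and the wrap-around
-- pass adds nothing.  Consequently, in the rewiring, each child subtree is
-- attached to its parent necklace by exactly one edge: the black edge to its
-- root, or the blue edge from the diamond to a triangle inside it.  Gluing
-- subtrees along one edge at a time then yields a spanning tree, acyclicity
-- being carried along in the form "every edge is a bridge".

module Submission where

open import Defs
open import Algebra.Bundles using (CommutativeMonoid)
open import Data.Bool using (Bool; true; false)
open import Data.Empty using (⊥; ⊥-elim)
open import Data.Fin using (zero; suc)
open import Data.List using (List; []; _∷_; _++_; [_]; length; lookup; map; removeAt)
open import Data.List.Properties using (length-++; ++-identityʳ)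
open import Data.List.Membership.Propositional using (_∈_)
open import Data.List.Membership.Propositional.Properties
  using (∈-++⁻; ∈-++⁺ˡ; ∈-++⁺ʳ; ∈-∃++; ∈-lookup)
open import Data.List.Relation.Unary.All as All using (All; []; _∷_)
open import Data.List.Relation.Unary.All.Properties as All using ()
open import Data.List.Relation.Unary.Any as Any using (here; there)
open import Data.List.Relation.Unary.Any.Properties using (lookup-index)
open import Data.List.Relation.Unary.AllPairs using (_∷_)
open import Data.List.Relation.Unary.Unique.Propositional using (Unique)
open import Data.List.Relation.Binary.Permutation.Propositional
  using (_↭_; ↭-refl; ↭-sym; ↭-trans; ↭-prep; ↭-swap; ↭-reflexive)
open import Data.List.Relation.Binary.Permutation.Propositional.Properties
  using (All-resp-↭; ∈-resp-↭; drop-∷; shift; ++⁺ˡ; ++⁺ʳ; ↭-length; ++-commutativeMonoid)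
open import Data.Nat using (ℕ; zero; suc; _+_; _≤_; _<_; z≤n; s≤s; _≤?_; _<?_)
open import Data.Nat.Properties
  using (≤-refl; ≤-trans; <-≤-trans; <⇒≤; <⇒≱; ≮⇒≥; n<1+n; m≤m+n; +-suc; +-identityʳ;
         +-assoc; m≤n⇒m<n∨m≡n; ≤-reflexive; +-commutativeSemigroup)
open import Data.Product using (∃; ∃₂; _×_; _,_; proj₁; proj₂)
open import Data.Sum as Sum using (_⊎_; inj₁; inj₂; swap)
open import Function using (_∘_; const)
open import Function.Bundles using (_⇔_; mk⇔; Equivalence)
open import Relation.Binary.Construct.Closure.ReflexiveTransitive as Star
  using (Star; ε; _◅_; _◅◅_)
open import Relation.Binary.PropositionalEquality
  using (_≡_; _≢_; refl; sym; trans; cong; cong₂; subst; module ≡-Reasoning)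
open import Relation.Nullary using (¬_; yes; no; _×-dec_)
open import Relation.Unary using (Pred; Decidable; ∁)

open import Algebra.Properties.CommutativeSemigroup +-commutativeSemigroup
  using () renaming (interchange to +-interchange)
open import Algebra.Properties.CommutativeSemigroup
  (CommutativeMonoid.commutativeSemigroup (++-commutativeMonoid {A = Edge}))
  using () renaming (interchange to ++-interchange-↭)

open Walked
open Pass1
open Equivalence using (to; from)

private
  variable
    A : Set
    x : A
    xs : List A
    E E′ E₁ E₂ : List Edge
    a b f f₁ f₂ p q u v w : ℕ

∈⇒↭∷ : x ∈ xs → ∃ λ ys → xs ↭ x ∷ ys
∈⇒↭∷ x∈xs with ys , zs , refl ← ∈-∃++ x∈xs = ys ++ zs , shift _ ys zs

↭-removeAt : ∀ (xs : List A) i → xs ↭ lookup xs i ∷ removeAt xs i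
↭-removeAt (x ∷ xs) zero    = ↭-refl
↭-removeAt (x ∷ xs) (suc i) =
  ↭-trans (↭-prep x (↭-removeAt xs i)) (↭-swap x (lookup xs i) ↭-refl)

lookup∈removeAt : ∀ (xs : List A) {i j} → j ≢ i → lookup xs j ∈ removeAt xs i
lookup∈removeAt (x ∷ xs) {zero}  {zero}  j≢i = ⊥-elim (j≢i refl)
lookup∈removeAt (x ∷ xs) {zero}  {suc j} _   = ∈-lookup j
lookup∈removeAt (x ∷ xs) {suc i} {zero}  _   = here refl
lookup∈removeAt (x ∷ xs) {suc i} {suc j} j≢i =
  there (lookup∈removeAt xs (j≢i ∘ cong suc))

Colouring : Set
Colouring = ℕ → Bool

Respects : Colouring → Edge → Set
Respects s e = s (proj₁ e) ≡ s (proj₂ e)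

-- Every edge (counted with multiplicity) is a bridge: some 2-colouring
-- separates its endpoints and is constant along all the other edges.
Forest : List Edge → Set
Forest E = ∀ {e R} → E ↭ e ∷ R → ∃ λ s → ¬ Respects s e × All (Respects s) R

Within : ∀ {ℓ} → Pred ℕ ℓ → Pred Edge ℓ
Within P e = P (proj₁ e) × P (proj₂ e)

forest-[] : Forest []
forest-[] σ with () ← ↭-length σ

forest-resp-↭ : E ↭ E′ → Forest E → Forest E′
forest-resp-↭ σ F τ = F (↭-trans σ τ)

walk-respects : ∀ {s : Colouring} {i} → (∀ j → j ≢ i → Respects s (lookup E j)) →
                ∀ {is} → Walk E u v is → All (i ≢_) is → s u ≡ s v
walk-respects others nil [] = refl
walk-respects {E} {s = s} others (step j e≡ rest) (i≢j ∷ i∉is) =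
  trans (across e≡) (walk-respects others rest i∉is)
  where
  respected : Respects s (lookup E j)
  respected = others j (i≢j ∘ sym)
  across : ∀ {u w} → lookup E j ≡ (u , w) ⊎ lookup E j ≡ (w , u) → s u ≡ s w
  across (inj₁ eq) = subst (Respects s) eq respected
  across (inj₂ eq) = sym (subst (Respects s) eq respected)

forest⇒acyclic : Forest E → ∀ u i is → Unique (i ∷ is) → Walk E u u (i ∷ is) → ⊥
forest⇒acyclic {E} F u i is (i∉is ∷ _) (step {w = w} .i e≡ rest)
  with s , separates , respects ← F (↭-removeAt E i) = separates (edge e≡)
  where
  back : s w ≡ s u
  back = walk-respects (λ j j≢i → All.lookup respects (lookup∈removeAt E j≢i)) rest i∉is
  edge : lookup E i ≡ (u , w) ⊎ lookup E i ≡ (w , u) → Respects s (lookup E i)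
  edge (inj₁ eq) = subst (Respects s) (sym eq) (sym back)
  edge (inj₂ eq) = subst (Respects s) (sym eq) back

respects-cong : ∀ {s t : Colouring} {e} → s (proj₁ e) ≡ t (proj₁ e) → s (proj₂ e) ≡ t (proj₂ e) →
                Respects s e ⇔ Respects t e
respects-cong eq₁ eq₂ =
  mk⇔ (λ r → trans (sym eq₁) (trans r eq₂)) (λ r → trans eq₁ (trans r (sym eq₂)))

respects-const : ∀ (c : Bool) E → All (Respects (const c)) E
respects-const c = All.universal (λ _ → refl)

module _ {ℓ} {P : Pred ℕ ℓ} (P? : Decidable P) where

  patch : Colouring → Colouring → Colouring
  patch s t x with P? x
  ... | yes _ = s x
  ... | no  _ = t x

  patch-in : ∀ {s t x} → P x → patch s t x ≡ s x
  patch-in {x = x} px with P? x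
  ... | yes _  = refl
  ... | no ¬px = ⊥-elim (¬px px)

  patch-out : ∀ {s t x} → ¬ P x → patch s t x ≡ t x
  patch-out {x = x} ¬px with P? x
  ... | yes px = ⊥-elim (¬px px)
  ... | no _   = refl

  patch-within : ∀ {s t e} → Within P e → Respects (patch s t) e ⇔ Respects s e
  patch-within {s} {t} {e} (px , py) = respects-cong {patch s t} {s} {e} (patch-in px) (patch-in py)

  patch-without : ∀ {s t e} → Within (∁ P) e → Respects (patch s t) e ⇔ Respects t e
  patch-without {s} {t} {e} (px , py) = respects-cong {patch s t} {t} {e} (patch-out px) (patch-out py)

  patch-respects : ∀ {s t} → All (Within P) E₁ → All (Respects s) E₁ →
                   All (Within (∁ P)) E₂ → All (Respects t) E₂ →
                   All (Respects (patch s t)) (E₁ ++ E₂)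
  patch-respects {s = s} {t} in₁ r₁ out₂ r₂ =
    All.++⁺ (All.zipWith (λ (i , r) → from (patch-within {s} {t} i) r) (in₁ , r₁))
            (All.zipWith (λ (o , r) → from (patch-without {s} {t} o) r) (out₂ , r₂))

  -- The colouring witnessing a bridge of one side is extended to the other
  -- side by a constant, chosen so that the joining edge is respected.
  forest-join : ¬ P q → P p → All (Within P) E₁ → Forest E₁ →
                All (Within (∁ P)) E₂ → Forest E₂ → Forest ((q , p) ∷ E₁ ++ E₂)
  forest-join {q} {p} {E₁} {E₂} q∉P p∈P in₁ F₁ out₂ F₂ {e} {R} σ
    with ∈-resp-↭ (↭-sym σ) (here refl)
  ... | here refl = s , separates , All-resp-↭ (drop-∷ σ) (patch-respects in₁ r₁ out₂ r₂)
    where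
    s = patch (const true) (const false)
    separates : ¬ Respects s (q , p)
    separates eq with () ← trans (sym (patch-out q∉P)) (trans eq (patch-in p∈P))
    r₁ = respects-const true E₁
    r₂ = respects-const false E₂
  ... | there e∈ with ∈-++⁻ E₁ e∈
  ... | inj₁ e∈E₁ with R₁ , ρ ← ∈⇒↭∷ e∈E₁ with s₁ , sep₁ , resp₁ ← F₁ ρ =
    s , sep₁ ∘ to (patch-within (All.head in-e∷R₁)) ,
    All-resp-↭ (drop-∷ (↭-trans (↭-sym rearranged) σ))
               (bridge ∷ patch-respects (All.tail in-e∷R₁) resp₁ out₂ (respects-const _ E₂))
    where
    s = patch s₁ (const (s₁ p))
    in-e∷R₁ = All-resp-↭ ρ in₁
    bridge : Respects s (q , p)
    bridge = trans (patch-out q∉P) (sym (patch-in p∈P))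
    rearranged : (q , p) ∷ E₁ ++ E₂ ↭ e ∷ (q , p) ∷ R₁ ++ E₂
    rearranged = ↭-trans (↭-prep _ (++⁺ʳ E₂ ρ)) (↭-swap _ _ ↭-refl)
  ... | inj₂ e∈E₂ with R₂ , ρ ← ∈⇒↭∷ e∈E₂ with s₂ , sep₂ , resp₂ ← F₂ ρ =
    s , sep₂ ∘ to (patch-without (All.head out-e∷R₂)) ,
    All-resp-↭ (drop-∷ (↭-trans (↭-sym rearranged) σ))
               (bridge ∷ patch-respects in₁ (respects-const _ E₁) (All.tail out-e∷R₂) resp₂)
    where
    s = patch (const (s₂ q)) s₂
    out-e∷R₂ = All-resp-↭ ρ out₂
    bridge : Respects s (q , p)
    bridge = trans (patch-out q∉P) (sym (patch-in p∈P))
    rearranged : (q , p) ∷ E₁ ++ E₂ ↭ e ∷ (q , p) ∷ E₁ ++ R₂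
    rearranged = ↭-trans (↭-prep _ (↭-trans (++⁺ˡ E₁ ρ) (shift e E₁ R₂))) (↭-swap _ _ ↭-refl)

Adjacent : List Edge → ℕ → ℕ → Set
Adjacent E u w = (u , w) ∈ E ⊎ (w , u) ∈ E

Path : List Edge → ℕ → ℕ → Set
Path E = Star (Adjacent E)

path-reverse : Path E u v → Path E v u
path-reverse = Star.reverse swap

path-mono : (∀ {e} → e ∈ E → e ∈ E′) → Path E u v → Path E′ u v
path-mono E⊆E′ = Star.map (Sum.map E⊆E′ E⊆E′)

adjacent⇒index : Adjacent E u w → ∃ λ i → lookup E i ≡ (u , w) ⊎ lookup E i ≡ (w , u)
adjacent⇒index (inj₁ uw∈E) = Any.index uw∈E , inj₁ (sym (lookup-index uw∈E))
adjacent⇒index (inj₂ wu∈E) = Any.index wu∈E , inj₂ (sym (lookup-index wu∈E))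

path⇒walk : Path E u v → ∃ λ is → Walk E u v is
path⇒walk ε = [] , nil
path⇒walk (adj ◅ path) with i , e≡ ← adjacent⇒index adj with is , walk ← path⇒walk path =
  i ∷ is , step i e≡ walk

Between : ℕ → ℕ → ℕ → Set
Between a b x = a ≤ x × x < b

between? : ∀ a b → Decidable (Between a b)
between? a b x = a ≤? x ×-dec x <? b

Span : ℕ → ℕ → ℕ → ℕ → Set
Span v a b x = x ≡ v ⊎ Between a b x

between-mono : ∀ {a′ b′} → a′ ≤ a → b ≤ b′ → Between a b x → Between a′ b′ x
between-mono a′≤a b≤b′ (a≤x , x<b) = ≤-trans a′≤a a≤x , <-≤-trans x<b b≤b′

span-mono : ∀ {a′ b′} → a′ ≤ a → b ≤ b′ → Span v a b x → Span v a′ b′ x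
span-mono _     _     (inj₁ x≡v) = inj₁ x≡v
span-mono a′≤a b≤b′ (inj₂ x∈)  = inj₂ (between-mono a′≤a b≤b′ x∈)

planted-span⇒between : f < b → Span f (suc f) b x → Between f b x
planted-span⇒between f<b (inj₁ refl)       = ≤-refl , f<b
planted-span⇒between f<b (inj₂ (f<x , x<b)) = <⇒≤ f<x , x<b

planted-span⇒span : f < f₁ → f₁ ≤ f₂ → Span f (suc f) f₁ x → Span v f f₂ x
planted-span⇒span f<f₁ f₁≤f₂ = inj₂ ∘ between-mono ≤-refl f₁≤f₂ ∘ planted-span⇒between f<f₁

record SpanningTree (v a b : ℕ) (E : List Edge) : Set where
  field
    within : All (Within (Span v a b)) E
    forest : Forest E
    reach  : Between a b u → Path E v u

spanningTree-[] : SpanningTree v a a []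
spanningTree-[] = record
  { within = []
  ; forest = forest-[]
  ; reach  = λ (a≤u , u<a) → ⊥-elim (<⇒≱ u<a a≤u)
  }

spanningTree-resp-↭ : E ↭ E′ → SpanningTree v a b E → SpanningTree v a b E′
spanningTree-resp-↭ σ T = record
  { within = All-resp-↭ σ within
  ; forest = forest-resp-↭ σ forest
  ; reach  = path-mono (∈-resp-↭ σ) ∘ reach
  }
  where open SpanningTree T

planted-reach : f < b → SpanningTree f (suc f) b E → Between f b u → Path E f u
planted-reach {u = u} f<b T (f≤u , u<b) with m≤n⇒m<n∨m≡n f≤u
... | inj₁ f<u  = SpanningTree.reach T (f<u , u<b)
... | inj₂ refl = ε

spanningTree-attach : v < f → f₁ ≤ f₂ → Between f f₁ p →
                      SpanningTree f (suc f) f₁ E₁ → SpanningTree v f₁ f₂ E₂ →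
                      SpanningTree v f f₂ ((v , p) ∷ E₁ ++ E₂)
spanningTree-attach {v} {f} {f₁} {f₂} {p} {E₁} {E₂} v<f f₁≤f₂ p∈ T₁ T₂ = record
  { within = (inj₁ refl , inj₂ (widen p∈)) ∷
             All.++⁺ (All.map (λ (x , y) → inj₂ (widen (child x)) , inj₂ (widen (child y))) T₁.within)
                     (All.map (λ (x , y) → rest x , rest y) T₂.within)
  ; forest = forest-join (between? f f₁) v∉ p∈
               (All.map (λ (x , y) → child x , child y) T₁.within) T₁.forest
               (All.map (λ (x , y) → outside x , outside y) T₂.within) T₂.forest
  ; reach  = reach
  }
  where
  module T₁ = SpanningTree T₁
  module T₂ = SpanningTree T₂
  f<f₁ : f < f₁
  f<f₁ = <-≤-trans (s≤s (proj₁ p∈)) (proj₂ p∈)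
  child : Span f (suc f) f₁ x → Between f f₁ x
  child = planted-span⇒between f<f₁
  widen : Between f f₁ x → Between f f₂ x
  widen = between-mono ≤-refl f₁≤f₂
  rest : Span v f₁ f₂ x → Span v f f₂ x
  rest = span-mono (<⇒≤ f<f₁) ≤-refl
  v∉ : ¬ Between f f₁ v
  v∉ (f≤v , _) = <⇒≱ v<f f≤v
  outside : Span v f₁ f₂ x → ¬ Between f f₁ x
  outside (inj₁ refl)     = v∉
  outside (inj₂ (f₁≤x , _)) (_ , x<f₁) = <⇒≱ x<f₁ f₁≤x
  reach : Between f f₂ u → Path ((v , p) ∷ E₁ ++ E₂) v u
  reach {u} (f≤u , u<f₂) with u <? f₁
  ... | yes u<f₁ = inj₁ (here refl) ◅ path-mono (there ∘ ∈-++⁺ˡ)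
                     (path-reverse (planted-reach f<f₁ T₁ p∈) ◅◅ planted-reach f<f₁ T₁ (f≤u , u<f₁))
  ... | no u≮f₁  = path-mono (there ∘ ∈-++⁺ʳ E₁) (T₂.reach (≮⇒≥ u≮f₁ , u<f₂))

spanningTree⇒isTree : ∀ {n V} → SpanningTree 0 1 (length (n ∷ V)) E → IsTree (nmap (n ∷ V) E)
spanningTree⇒isTree {E} {n} {V} T = record
  { wellFormed = All.map (λ (x , y) → bounded x , bounded y) within
  ; connected  = λ u w u< w< → path⇒walk (path-reverse (from-root u<) ◅◅ from-root w<)
  ; acyclic    = forest⇒acyclic forest
  }
  where
  open SpanningTree T
  bounded : Span 0 1 (length (n ∷ V)) x → x < length (n ∷ V)
  bounded (inj₁ refl)    = s≤s z≤n
  bounded (inj₂ (_ , x<)) = x<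
  from-root : u < length (n ∷ V) → Path E 0 u
  from-root {zero}  _  = ε
  from-root {suc u} u< = reach (s≤s z≤n , u<)

scan-++ : ∀ s xs ys → scan s (xs ++ ys) ≡
  pass1 (blue1 (scan s xs) ++ blue1 (scan (stack (scan s xs)) ys))
        (stack (scan (stack (scan s xs)) ys))
        (freeTris (scan s xs) ++ freeTris (scan (stack (scan s xs)) ys))
scan-++ s       []             ys = refl
scan-++ s       (diaC v ∷ xs) ys = scan-++ (v ∷ s) xs ys
scan-++ []      (triC w ∷ xs) ys =
  cong (λ S → pass1 (blue1 S) (stack S) (w ∷ freeTris S)) (scan-++ [] xs ys)
scan-++ (v ∷ s) (triC w ∷ xs) ys =
  cong (λ S → pass1 ((v , w) ∷ blue1 S) (stack S) (freeTris S)) (scan-++ s xs ys)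

scan-++-balanced : ∀ s xs ys {b₁ t₁ b₂ t₂} →
                   scan s xs ≡ pass1 b₁ [] t₁ → scan [] ys ≡ pass1 b₂ [] t₂ →
                   scan s (xs ++ ys) ≡ pass1 (b₁ ++ b₂) [] (t₁ ++ t₂)
scan-++-balanced s xs ys eq₁ eq₂ rewrite scan-++ s xs ys | eq₁ | eq₂ = refl

-- A diamond at the bottom of the stack is only reached by the first triangle
-- that the scan without it would have left free.
scan-push-bottom : ∀ st cs {v w ts} → freeTris (scan st cs) ≡ w ∷ ts →
  stack (scan (st ++ [ v ]) cs) ≡ stack (scan st cs) ×
  freeTris (scan (st ++ [ v ]) cs) ≡ ts ×
  blue1 (scan (st ++ [ v ]) cs) ↭ (v , w) ∷ blue1 (scan st cs)
scan-push-bottom st       []             ()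
scan-push-bottom st       (diaC u ∷ cs) eq   = scan-push-bottom (u ∷ st) cs eq
scan-push-bottom []       (triC w ∷ cs) refl = refl , refl , ↭-refl
scan-push-bottom (u ∷ st) (triC w ∷ cs) eq
  with stack≡ , free≡ , blue↭ ← scan-push-bottom st cs eq =
  stack≡ , free≡ , ↭-trans (↭-prep _ blue↭) (↭-swap _ _ ↭-refl)

scan-match-bottom : ∀ cs {b w ts} → scan [] cs ≡ pass1 b [] (w ∷ ts) →
                    ∃ λ b′ → scan [ v ] cs ≡ pass1 b′ [] ts × b′ ↭ (v , w) ∷ b
scan-match-bottom {v} cs {w = w} eq
  with stack≡ , free≡ , blue↭ ← scan-push-bottom [] cs {v} (cong freeTris eq) =
  _ , cong₂ (pass1 _) (trans stack≡ (cong stack eq)) free≡ ,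
  ↭-trans blue↭ (↭-reflexive (cong (λ S → (v , w) ∷ blue1 S) eq))

blueEdges-balanced : ∀ cs {b ts} → scan [] cs ≡ pass1 b [] ts → blueEdges cs ≡ b
blueEdges-balanced cs {b} eq rewrite eq = ++-identityʳ b

mutual
  walkPs-next : ∀ v f ps → next (walkPs v f ps) ≡ f + length (necks (walkPs v f ps))
  walkPs-next v f []                        = sym (+-identityʳ f)
  walkPs-next v f (triangleP ∷ ps)          = walkPs-next v f ps
  walkPs-next v f (dotP (neck qs) ∷ ps)     = walkPs-next-child v f qs ps
  walkPs-next v f (diamondP (neck qs) ∷ ps) = walkPs-next-child v f qs ps

  walkPs-next-child : ∀ v f qs ps →
    let W₁ = walkPs f (suc f) qs ; W₂ = walkPs v (next W₁) ps in
    next W₂ ≡ f + suc (length (necks W₁ ++ necks W₂))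
  walkPs-next-child v f qs ps = begin
    next W₂                           ≡⟨ walkPs-next v (next W₁) ps ⟩
    next W₁ + length (necks W₂)       ≡⟨ cong (_+ length (necks W₂)) (walkPs-next f (suc f) qs) ⟩
    suc f + length (necks W₁) + length (necks W₂)   ≡⟨ +-assoc (suc f) _ _ ⟩
    suc f + (length (necks W₁) + length (necks W₂)) ≡⟨ sym (+-suc f _) ⟩
    f + suc (length (necks W₁) + length (necks W₂)) ≡⟨ cong (λ n → f + suc n) (sym (length-++ (necks W₁))) ⟩
    f + suc (length (necks W₁ ++ necks W₂))         ∎
    where
    open ≡-Reasoning
    W₁ = walkPs f (suc f) qs
    W₂ = walkPs v (next W₁) ps

walkPs-≤ : ∀ v f ps → f ≤ next (walkPs v f ps)
walkPs-≤ v f ps = subst (f ≤_) (sym (walkPs-next v f ps)) (m≤m+n f _)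

-- ps are the pearls of necklace v, whose descendants are numbered from f on.
record Closes (v f : ℕ) (ps : List Pearl) (blue : List Edge) (free : List ℕ) : Set where
  field
    scan-corners : scan [] (corners (walkPs v f ps)) ≡ pass1 blue [] free
    free-count   : length free + diasPs ps ≡ trisPs ps
    free-span    : All (Span v f (next (walkPs v f ps))) free
    tree         : SpanningTree v f (next (walkPs v f ps)) (black (walkPs v f ps) ++ blue)

Closed : ℕ → ℕ → List Pearl → Set
Closed v f ps = ∃₂ (Closes v f ps)

length-++-+ : ∀ (t₁ t₂ : List ℕ) d₁ d₂ →
              length (t₁ ++ t₂) + (d₁ + d₂) ≡ (length t₁ + d₁) + (length t₂ + d₂)
length-++-+ t₁ t₂ d₁ d₂ =
  trans (cong (_+ (d₁ + d₂)) (length-++ t₁)) (+-interchange (length t₁) (length t₂) d₁ d₂)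

closed-[] : Closed v f []
closed-[] = [] , [] , record
  { scan-corners = refl
  ; free-count   = refl
  ; free-span    = []
  ; tree         = spanningTree-[]
  }

closed-triangle : ∀ {ps} → Closed v f ps → Closed v f (triangleP ∷ ps)
closed-triangle {v} (b , t , C) = b , v ∷ t , record
  { scan-corners = cong (λ S → pass1 (blue1 S) (stack S) (v ∷ freeTris S)) scan-corners
  ; free-count   = cong suc free-count
  ; free-span    = inj₁ refl ∷ free-span
  ; tree         = tree
  }
  where open Closes C

closed-dot : ∀ {qs ps} → v < f → Closed f (suc f) qs → Closed v (next (walkPs f (suc f) qs)) ps →
             Closed v f (dotP (neck qs) ∷ ps)
closed-dot {v} {f} {qs} {ps} v<f (b₁ , t₁ , C) (b₂ , t₂ , D) = b₁ ++ b₂ , t₁ ++ t₂ , record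
  { scan-corners = scan-++-balanced [] (corners W₁) (corners W₂) C.scan-corners D.scan-corners
  ; free-count   = trans (length-++-+ t₁ t₂ (diasPs qs) (diasPs ps))
                         (cong₂ _+_ C.free-count D.free-count)
  ; free-span    = All.++⁺ (All.map (planted-span⇒span f<f₁ f₁≤f₂) C.free-span)
                           (All.map (span-mono (<⇒≤ f<f₁) ≤-refl) D.free-span)
  ; tree         = spanningTree-resp-↭
                     (↭-prep _ (↭-sym (++-interchange-↭ (black W₁) (black W₂) b₁ b₂)))
                     (spanningTree-attach v<f f₁≤f₂ (≤-refl , f<f₁) C.tree D.tree)
  }
  where
  module C = Closes C
  module D = Closes D
  W₁ = walkPs f (suc f) qs
  W₂ = walkPs v (next W₁) ps
  f<f₁ : f < next W₁
  f<f₁ = walkPs-≤ f (suc f) qs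
  f₁≤f₂ : next W₁ ≤ next W₂
  f₁≤f₂ = walkPs-≤ v (next W₁) ps

-- The red edge to the child is replaced by the blue edge to the first free
-- triangle w of the child, which exists because the diamond has positive excess.
closed-diamond : ∀ {qs ps} → v < f → suc (diasPs qs) ≤ trisPs qs →
                 Closed f (suc f) qs → Closed v (next (walkPs f (suc f) qs)) ps →
                 Closed v f (diamondP (neck qs) ∷ ps)
closed-diamond _ excess (_ , [] , C) _ =
  ⊥-elim (<⇒≱ excess (≤-reflexive (sym (Closes.free-count C))))
closed-diamond {v} {f} {qs} {ps} v<f _ (b₁ , w ∷ t₁ , C) (b₂ , t₂ , D)
  with b₁′ , scan≡ , b₁′↭ ← scan-match-bottom {v} (corners (walkPs f (suc f) qs)) (Closes.scan-corners C) =
  b₁′ ++ b₂ , t₁ ++ t₂ , record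
  { scan-corners = scan-++-balanced [ v ] (corners W₁) (corners W₂) scan≡ D.scan-corners
  ; free-count   = trans (+-suc (length (t₁ ++ t₂)) _)
                     (trans (cong suc (length-++-+ t₁ t₂ (diasPs qs) (diasPs ps)))
                            (cong₂ _+_ C.free-count D.free-count))
  ; free-span    = All.++⁺ (All.map (planted-span⇒span f<f₁ f₁≤f₂) (All.tail C.free-span))
                           (All.map (span-mono (<⇒≤ f<f₁) ≤-refl) D.free-span)
  ; tree         = spanningTree-resp-↭ (↭-sym rearranged)
                     (spanningTree-attach v<f f₁≤f₂ w∈ C.tree D.tree)
  }
  where
  module C = Closes C
  module D = Closes D
  W₁ = walkPs f (suc f) qs
  W₂ = walkPs v (next W₁) ps
  f<f₁ : f < next W₁
  f<f₁ = walkPs-≤ f (suc f) qs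
  f₁≤f₂ : next W₁ ≤ next W₂
  f₁≤f₂ = walkPs-≤ v (next W₁) ps
  w∈ : Between f (next W₁) w
  w∈ = planted-span⇒between f<f₁ (All.head C.free-span)
  bs = black W₁ ++ black W₂
  rearranged : bs ++ (b₁′ ++ b₂) ↭ (v , w) ∷ (black W₁ ++ b₁) ++ (black W₂ ++ b₂)
  rearranged = ↭-trans (++⁺ˡ bs (++⁺ʳ b₂ b₁′↭))
                 (↭-trans (shift (v , w) bs (b₁ ++ b₂))
                   (↭-prep _ (++-interchange-↭ (black W₁) (black W₂) b₁ b₂)))

closed : ∀ ps → v < f → NonNegPs ps → Closed v f ps
closed []                        _   []         = closed-[]
closed (triangleP ∷ ps)          v<f (tri∷ nn) = closed-triangle (closed ps v<f nn)
closed {f = f} (dotP (neck qs) ∷ ps) v<f (dot∷ _ (neck _ nn-qs) nn-ps) =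
  closed-dot v<f (closed qs (n<1+n f) nn-qs)
                 (closed ps (<-≤-trans v<f (<⇒≤ (walkPs-≤ f (suc f) qs))) nn-ps)
closed {f = f} (diamondP (neck qs) ∷ ps) v<f (dia∷ excess (neck _ nn-qs) nn-ps) =
  closed-diamond v<f excess (closed qs (n<1+n f) nn-qs)
                 (closed ps (<-≤-trans v<f (<⇒≤ (walkPs-≤ f (suc f) qs))) nn-ps)

proposition2p4 : (Q : List Letter → Set) (τ : QTree) → IsQTree Q τ → NonNeg τ →
    IsTree (rewiring τ) × vertices (rewiring τ) ≡ necklaces τ
proposition2p4 Q (neck ps) _ (neck _ nn) with blue , _ , C ← closed {0} {1} ps (s≤s z≤n) nn =
  subst (IsTree ∘ nmap V ∘ (black W ++_)) (sym (blueEdges-balanced (corners W) scan-corners))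
        (spanningTree⇒isTree (subst (λ n → SpanningTree 0 1 n (black W ++ blue)) (walkPs-next 0 1 ps) tree)) ,
  refl
  where
  open Closes C
  W = walkPs 0 1 ps
  V = map letter ps ∷ necks W
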